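{- For $n\in\omega$ let $\beta_n\in\omega^\omega$ be given by $\beta_n(i)=i+n$, and let $B_n:=A^{S_{\beta_n}}$. Then for every $n\in\omega$, $B_{n+1}\leq^r_c B_n$ and $B_n\not\leq^r_c B_{n+1}$.
   Context: For $\beta\in\omega^\omega$, $S_\beta:=\{\sum_{i<l}(1+\beta(i)): l\in\omega\}$. For $S\subseteq\omega$, $A^S:=\{(s0\gamma,s1\gamma): s\in 2^{<\omega},\ \text{the number of 1's in } s \text{ belongs to } S,\ \gamma\in 2^\omega\}\subseteq 2^\omega\times 2^\omega$. $A\leq^r_c A'$ means there are continuous $u,v:2^\omega\to 2^\omega$ with $A=(u\times v)^{ -1}(A')$. -}

module Defs where

open import Data.Nat using (ℕ; zero; suc; _+_; _<_)
open import Data.Bool using (Bool; true; false)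
open import Data.List using (List; []; _∷_; _++_)
open import Data.Product using (Σ; Σ-syntax; _×_; ∃; ∃-syntax)
open import Function.Bundles using (_⇔_)
open import Relation.Binary.PropositionalEquality using (_≡_)

Cantor : Set
Cantor = ℕ → Bool

_≈[_]_ : Cantor → ℕ → Cantor → Set
x ≈[ n ] y = ∀ i → i < n → x i ≡ y i

Continuous : (Cantor → Cantor) → Set
Continuous u = ∀ (x : Cantor) (n : ℕ) → ∃[ m ] (∀ (y : Cantor) → x ≈[ m ] y → u x ≈[ n ] u y)

_⊕_ : List Bool → Cantor → Cantor
([] ⊕ γ) i = γ i
((b ∷ s) ⊕ γ) zero = b
((b ∷ s) ⊕ γ) (suc i) = (s ⊕ γ) i

ones : List Bool → ℕ
ones [] = 0
ones (true ∷ s) = suc (ones s)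
ones (false ∷ s) = ones s

sumTo : ℕ → (ℕ → ℕ) → ℕ
sumTo zero f = 0
sumTo (suc l) f = sumTo l f + f l

S : (ℕ → ℕ) → ℕ → Set
S β k = ∃[ l ] k ≡ sumTo l (λ i → suc (β i))

A : (ℕ → Set) → Cantor → Cantor → Set
A T x y = Σ[ s ∈ List Bool ] Σ[ γ ∈ Cantor ]
  (T (ones s) × (∀ i → x i ≡ ((s ++ (false ∷ [])) ⊕ γ) i)
              × (∀ i → y i ≡ ((s ++ (true ∷ [])) ⊕ γ) i))

_≤rc_ : (Cantor → Cantor → Set) → (Cantor → Cantor → Set) → Set
P ≤rc Q = Σ[ u ∈ (Cantor → Cantor) ] Σ[ v ∈ (Cantor → Cantor) ]
  (Continuous u × Continuous v × (∀ x y → P x y ⇔ Q (u x) (v y)))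

β : ℕ → ℕ → ℕ
β n i = i + n

B : ℕ → Cantor → Cantor → Set
B n = A (S (β n))

-- A pair (x, y) lies in A^T exactly when y arises from x by switching one bit from 0 to 1 at a
-- position p such that the number of 1's of x below p lies in T.
--
-- Prepending n+1 ones to both coordinates shifts these counts by n+1, which carries S_{β_{n+1}}
-- onto the nonzero part of S_{β_n}; this gives B_{n+1} ≤ B_n.
--
-- Conversely, let u, v reduce B_n to B_{n+1}. Every eventually-one point y is a limit of points
-- y' with (y', y) ∈ B_n, so by continuity v y is a one-bit flip of points arbitrarily close to
-- u y; as (y, y) ∉ B_n this forces u y = v y. Hence u maps chains of B_n-flips between
-- eventually-one points to chains of B_{n+1}-flips. Consecutive elements of S_{β_{n+1}} are at
-- least n+2 apart, while along a chain of n+2 flips the count below a fixed position moves by at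
-- most one per step; so two such chains with common ends share their penultimate point. Two
-- chains from 01^ω to 0^{n+3}1^ω with penultimate points 0^{n+2}1^ω and 0^{n+1}101^ω then force
-- these two points to have the same image under u, although only the first is B_n-related to
-- 10^{n+1}1^ω.
module Submission where

open import Data.Bool using (Bool; true; false; if_then_else_)
open import Data.Empty using (⊥; ⊥-elim)
open import Data.List using ([]; _∷_; _++_; length; replicate; applyUpTo)
open import Data.List.Properties using (applyUpTo-∷ʳ)
open import Data.Nat using (ℕ; zero; suc; _+_; _∸_; _≤_; _<_; z≤n; s≤s; _≟_; _≤?_; _<?_)
open import Data.Nat.Properties
open import Data.Product using (_×_; _,_; ∃-syntax)
open import Data.Sum using (inj₁; inj₂)
open import Function.Bundles using (_⇔_; mk⇔; Equivalence)
open import Relation.Binary.Definitions using (tri<; tri≈; tri>)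
open import Relation.Binary.PropositionalEquality
open import Relation.Nullary using (¬_; Dec; does; yes; no; contradiction)
open import Relation.Nullary.Decidable using (dec-true; dec-false)
open import Defs

_⊆_ : Cantor → Cantor → Set
x ⊆ y = ∀ i → x i ≡ true → y i ≡ true

_[_≔_] : Cantor → ℕ → Bool → Cantor
(x [ p ≔ b ]) i = if does (i ≟ p) then b else x i

update-≡ : ∀ x p b → (x [ p ≔ b ]) p ≡ b
update-≡ x p b rewrite dec-true (p ≟ p) refl = refl

update-≢ : ∀ x {p i} b → i ≢ p → (x [ p ≔ b ]) i ≡ x i
update-≢ x {p} {i} b i≢p rewrite dec-false (i ≟ p) i≢p = refl

update-self : ∀ {x p b} → x p ≡ b → x ≗ x [ p ≔ b ]
update-self {x} {p} {b} xp≡b i with i ≟ p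
... | yes refl = trans xp≡b (sym (update-≡ x p b))
... | no i≢p   = sym (update-≢ x b i≢p)

EventuallyOne : Cantor → Set
EventuallyOne x = ∃[ M ] (∀ i → M ≤ i → x i ≡ true)

update-eventuallyOne : ∀ {x} p b → EventuallyOne x → EventuallyOne (x [ p ≔ b ])
update-eventuallyOne {x} p b (M , x≥M) = suc p + M , λ i le →
  trans (update-≢ x b (λ { refl → <-irrefl refl (≤-trans (m≤m+n (suc p) M) le) }))
        (x≥M i (≤-trans (m≤n+m M (suc p)) le))

continuous-≗ : ∀ {u} → Continuous u → ∀ {x y} → x ≗ y → u x ≗ u y
continuous-≗ cu {x} {y} x≗y i with cu x (suc i)
... | _ , close = close y (λ j _ → x≗y j) i ≤-refl

bit : Bool → ℕ
bit false = 0
bit true  = 1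

count : Cantor → ℕ → ℕ
count x p = ones (applyUpTo x p)

ones-++ : ∀ s t → ones (s ++ t) ≡ ones s + ones t
ones-++ []          t = refl
ones-++ (true ∷ s)  t = cong suc (ones-++ s t)
ones-++ (false ∷ s) t = ones-++ s t

count-suc : ∀ x q → count x (suc q) ≡ count x q + bit (x q)
count-suc x q = begin
  ones (applyUpTo x (suc q))        ≡⟨ cong ones (applyUpTo-∷ʳ x q) ⟨
  ones (applyUpTo x q ++ x q ∷ [])  ≡⟨ ones-++ (applyUpTo x q) (x q ∷ []) ⟩
  count x q + ones (x q ∷ [])       ≡⟨ cong (count x q +_) (ones-singleton (x q)) ⟩
  count x q + bit (x q)             ∎
  where
  open ≡-Reasoning
  ones-singleton : ∀ b → ones (b ∷ []) ≡ bit b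
  ones-singleton false = refl
  ones-singleton true  = refl

applyUpTo-cong : ∀ {x y : Cantor} q → x ≈[ q ] y → applyUpTo x q ≡ applyUpTo y q
applyUpTo-cong zero    _   = refl
applyUpTo-cong (suc q) x≈y =
  cong₂ _∷_ (x≈y 0 (s≤s z≤n)) (applyUpTo-cong q (λ i i<q → x≈y (suc i) (s≤s i<q)))

count-cong : ∀ {x y} q → x ≈[ q ] y → count x q ≡ count y q
count-cong q x≈y = cong ones (applyUpTo-cong q x≈y)

count-update : ∀ x {p i} b → p ≤ i → count (x [ i ≔ b ]) p ≡ count x p
count-update x b p≤i = count-cong _ (λ j j<p → update-≢ x b (<⇒≢ (<-≤-trans j<p p≤i)))

count-mono : ∀ {x y} → x ⊆ y → ∀ q → count x q ≤ count y q
count-mono x⊆y zero = z≤n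
count-mono {x} {y} x⊆y (suc q) = begin
  count x (suc q)        ≡⟨ count-suc x q ⟩
  count x q + bit (x q)  ≤⟨ +-mono-≤ (count-mono x⊆y q) (bit-mono (x⊆y q)) ⟩
  count y q + bit (y q)  ≡⟨ count-suc y q ⟨
  count y (suc q)        ∎
  where
  open ≤-Reasoning
  bit-mono : ∀ {a b} → (a ≡ true → b ≡ true) → bit a ≤ bit b
  bit-mono {false} _   = z≤n
  bit-mono {true}  a⇒b rewrite a⇒b refl = ≤-refl

count-eventuallyOne : ∀ {y M} → (∀ i → M ≤ i → y i ≡ true) →
  ∀ t → count y (M + t) ≡ count y M + t
count-eventuallyOne {y} {M} _ zero = trans (cong (count y) (+-identityʳ M)) (sym (+-identityʳ _))
count-eventuallyOne {y} {M} y≥M (suc t) = begin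
  count y (M + suc t)                 ≡⟨ cong (count y) (+-suc M t) ⟩
  count y (suc (M + t))               ≡⟨ count-suc y (M + t) ⟩
  count y (M + t) + bit (y (M + t))   ≡⟨ cong₂ _+_ (count-eventuallyOne y≥M t)
                                                  (cong bit (y≥M (M + t) (m≤m+n M t))) ⟩
  count y M + t + 1                   ≡⟨ +-assoc (count y M) t 1 ⟩
  count y M + (t + 1)                 ≡⟨ cong (count y M +_) (+-comm t 1) ⟩
  count y M + suc t                   ∎
  where open ≡-Reasoning

record Flip (x : Cantor) (p : ℕ) (y : Cantor) : Set where
  field
    off   : x p ≡ false
    on    : y p ≡ true
    agree : ∀ i → i ≢ p → x i ≡ y i

open Flip

Flip-by-update : ∀ {x y z} p → x ≗ z [ p ≔ false ] → y ≗ z [ p ≔ true ] → Flip x p y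
Flip-by-update {z = z} p x≗ y≗ = record
  { off   = trans (x≗ p) (update-≡ z p false)
  ; on    = trans (y≗ p) (update-≡ z p true)
  ; agree = λ i i≢p →
      trans (x≗ i) (trans (update-≢ z false i≢p) (sym (trans (y≗ i) (update-≢ z true i≢p))))
  }

Flip⇒≗off : ∀ {x p y} → Flip x p y → x ≗ y [ p ≔ false ]
Flip⇒≗off {x} {p} {y} f i with i ≟ p
... | yes refl = trans (off f) (sym (update-≡ y p false))
... | no i≢p   = trans (agree f i i≢p) (sym (update-≢ y false i≢p))

Flip⇒≗on : ∀ {x p y} → Flip x p y → y ≗ x [ p ≔ true ]
Flip⇒≗on {x} {p} {y} f i with i ≟ p
... | yes refl = trans (on f) (sym (update-≡ x p true))
... | no i≢p   = trans (sym (agree f i i≢p)) (sym (update-≢ x true i≢p))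

Flip-⊆ : ∀ {x p y} → Flip x p y → x ⊆ y
Flip-⊆ {p = p} f i xi with i ≟ p
... | yes refl = on f
... | no i≢p   = trans (sym (agree f i i≢p)) xi

Flip-functional : ∀ {x x' p y y'} → Flip x p y → Flip x' p y' → x ≗ x' → y ≗ y'
Flip-functional {p = p} f f' x≗x' i with i ≟ p
... | yes refl = trans (on f) (sym (on f'))
... | no i≢p   = trans (sym (agree f i i≢p)) (trans (x≗x' i) (agree f' i i≢p))

Flip-update : ∀ {x p y i} b → i ≢ p → Flip x p y → Flip (x [ i ≔ b ]) p (y [ i ≔ b ])
Flip-update {x} {p} {y} {i} b i≢p f = record
  { off   = trans (update-≢ x b (≢-sym i≢p)) (off f)
  ; on    = trans (update-≢ y b (≢-sym i≢p)) (on f)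
  ; agree = agree-updated
  }
  where
  agree-updated : ∀ j → j ≢ p → (x [ i ≔ b ]) j ≡ (y [ i ≔ b ]) j
  agree-updated j j≢p with j ≟ i
  ... | yes refl = trans (update-≡ x j b) (sym (update-≡ y j b))
  ... | no j≢i   = trans (update-≢ x b j≢i) (trans (agree f j j≢p) (sym (update-≢ y b j≢i)))

count-flip-≤ : ∀ {x p y q} → Flip x p y → q ≤ p → count y q ≡ count x q
count-flip-≤ f q≤p = count-cong _ (λ i i<q → sym (agree f i (λ { refl → <⇒≱ i<q q≤p })))

count-flip-> : ∀ {x p y q} → Flip x p y → p < q → count y q ≡ suc (count x q)
count-flip-> {x} {p} {y} {suc q} f (s≤s p≤q) with m≤n⇒m<n∨m≡n p≤q
... | inj₂ refl = begin
  count y (suc p)              ≡⟨ count-suc y p ⟩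
  count y p + bit (y p)        ≡⟨ cong₂ _+_ (count-flip-≤ f ≤-refl) (cong bit (on f)) ⟩
  count x p + 1                ≡⟨ +-suc (count x p) 0 ⟩
  suc (count x p + 0)          ≡⟨ cong (λ b → suc (count x p + bit b)) (off f) ⟨
  suc (count x p + bit (x p))  ≡⟨ cong suc (count-suc x p) ⟨
  suc (count x (suc p))        ∎
  where open ≡-Reasoning
... | inj₁ p<q = begin
  count y (suc q)              ≡⟨ count-suc y q ⟩
  count y q + bit (y q)        ≡⟨ cong₂ _+_ (count-flip-> f p<q)
                                            (cong bit (sym (agree f q (>⇒≢ p<q)))) ⟩
  suc (count x q) + bit (x q)  ≡⟨ cong suc (count-suc x q) ⟨
  suc (count x (suc q))        ∎
  where open ≡-Reasoning

count-flip-≤-suc : ∀ {x p y} → Flip x p y → ∀ q → count y q ≤ suc (count x q)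
count-flip-≤-suc {p = p} f q with p <? q
... | yes p<q = ≤-reflexive (count-flip-> f p<q)
... | no p≮q  = ≤-trans (≤-reflexive (count-flip-≤ f (≮⇒≥ p≮q))) (n≤1+n _)

applyUpTo-⊕-update : ∀ x p b → (applyUpTo x p ++ b ∷ []) ⊕ (λ k → x (p + suc k)) ≗ x [ p ≔ b ]
applyUpTo-⊕-update x zero    b zero    = refl
applyUpTo-⊕-update x zero    b (suc i) = refl
applyUpTo-⊕-update x (suc p) b zero    = refl
applyUpTo-⊕-update x (suc p) b (suc i) = applyUpTo-⊕-update (λ k → x (suc k)) p b i

⊕-snoc-update : ∀ s b b' γ → (s ++ b ∷ []) ⊕ γ ≗ ((s ++ b' ∷ []) ⊕ γ) [ length s ≔ b ]
⊕-snoc-update []      b b' γ zero    = refl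
⊕-snoc-update []      b b' γ (suc i) = refl
⊕-snoc-update (c ∷ s) b b' γ zero    = refl
⊕-snoc-update (c ∷ s) b b' γ (suc i) = ⊕-snoc-update s b b' γ i

applyUpTo-⊕ : ∀ {x} s t γ → x ≗ (s ++ t) ⊕ γ → applyUpTo x (length s) ≡ s
applyUpTo-⊕ []      t γ _   = refl
applyUpTo-⊕ (c ∷ s) t γ x≗ = cong₂ _∷_ (x≗ 0) (applyUpTo-⊕ s t γ (λ i → x≗ (suc i)))

Flip⇒A : ∀ {T x p y} → Flip x p y → T (count x p) → A T x y
Flip⇒A {x = x} {p} f t = applyUpTo x p , (λ k → x (p + suc k)) , t ,
  (λ i → trans (update-self (off f) i) (sym (applyUpTo-⊕-update x p false i))) ,
  (λ i → trans (Flip⇒≗on f i) (sym (applyUpTo-⊕-update x p true i)))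

A⇒Flip : ∀ {T x y} → A T x y → ∃[ p ] (Flip x p y × T (count x p))
A⇒Flip {T} (s , γ , t , x≗ , y≗) = length s ,
  Flip-by-update (length s) (λ i → trans (x≗ i) (⊕-snoc-update s false true γ i))
                            (λ i → trans (y≗ i) (⊕-snoc-update s true true γ i)) ,
  subst (λ s' → T (ones s')) (sym (applyUpTo-⊕ s _ γ x≗)) t

A-resp-≗ : ∀ {T x x' y y'} → x ≗ x' → y ≗ y' → A T x y → A T x' y'
A-resp-≗ x≗x' y≗y' (s , γ , t , x≗ , y≗) =
  s , γ , t , (λ i → trans (sym (x≗x' i)) (x≗ i)) , (λ i → trans (sym (y≗y' i)) (y≗ i))

A⇒⊆ : ∀ {T x y} → A T x y → x ⊆ y
A⇒⊆ {T} a with A⇒Flip {T} a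
... | _ , f , _ = Flip-⊆ f

A-irreflexive : ∀ {T x} → ¬ A T x x
A-irreflexive {T} a with A⇒Flip {T} a
... | _ , f , _ = contradiction (trans (sym (off f)) (on f)) λ ()

update-A : ∀ {T} x p → T (count x p) → A T (x [ p ≔ false ]) (x [ p ≔ true ])
update-A {T} x p t =
  Flip⇒A {T} (Flip-by-update p (λ _ → refl) (λ _ → refl))
    (subst T (sym (count-update x {p} false ≤-refl)) t)

switch-off-A : ∀ {T x p} → x p ≡ true → T (count x p) → A T (x [ p ≔ false ]) x
switch-off-A {T} xp t = A-resp-≗ {T} (λ _ → refl) (λ i → sym (update-self xp i)) (update-A {T} _ _ t)

flip-limit : ∀ {T x y} → (∀ q → ∃[ z ] (z ≈[ q ] x × A T z y)) → ¬ A T x y → x ≗ y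
flip-limit {T} {x} {y} approx ¬xy i with approx (suc i)
... | z , z≈x , zy with A⇒Flip {T} zy
... | d , f , Td with i ≟ d
... | no i≢d   = trans (sym (z≈x i ≤-refl)) (agree f i i≢d)
... | yes refl =
  ⊥-elim (¬xy (Flip⇒A {T} flip (subst T (count-cong i (λ j j<i → z≈x j (m<n⇒m<1+n j<i))) Td)))
  where
  x-off : x i ≡ false
  x-off = trans (sym (z≈x i ≤-refl)) (off f)

  -- An approximation exact at i and j either flips at i too, or would force x i ≡ y i.
  agree-elsewhere : ∀ j → j ≢ i → x j ≡ y j
  agree-elsewhere j j≢i with approx (suc (i + j))
  ... | z' , z'≈x , z'y with A⇒Flip {T} z'y
  ... | d' , f' , _ with d' ≟ i
  ... | yes refl = trans (sym (z'≈x j (s≤s (m≤n+m j i)))) (agree f' j j≢i)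
  ... | no d'≢i  = contradiction
    (trans (sym x-off) (trans (sym (z'≈x i (s≤s (m≤m+n i j))))
                              (trans (agree f' i (≢-sym d'≢i)) (on f)))) λ ()

  flip : Flip x i y
  flip = record { off = x-off ; on = on f ; agree = agree-elsewhere }

sumTo-mono : ∀ f {l l'} → l ≤ l' → sumTo l f ≤ sumTo l' f
sumTo-mono f {l} {zero}   z≤n = ≤-refl
sumTo-mono f {l} {suc l'} l≤l' with m≤n⇒m<n∨m≡n l≤l'
... | inj₂ refl      = ≤-refl
... | inj₁ (s≤s l≤l'') = ≤-trans (sumTo-mono f l≤l'') (m≤m+n (sumTo l' f) (f l'))

S-cofinal : ∀ β b → ∃[ s ] (b ≤ s × S β s)
S-cofinal β b = sumTo b f , sumTo-≥ b , b , refl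
  where
  f : ℕ → ℕ
  f i = suc (β i)
  sumTo-≥ : ∀ l → l ≤ sumTo l f
  sumTo-≥ zero    = z≤n
  sumTo-≥ (suc l) = subst (_≤ sumTo (suc l) f) (+-comm l 1) (+-mono-≤ (sumTo-≥ l) (s≤s z≤n))

switch-off-in-S : ∀ β {y} → EventuallyOne y → ∀ m → ∃[ N ] (m ≤ N × A (S β) (y [ N ≔ false ]) y)
switch-off-in-S β {y} (M , y≥M) m with S-cofinal β (count y M + m)
... | s , c+m≤s , s∈S =
  N , m≤N , switch-off-A {S β} (y≥M N (m≤m+n M t)) (subst (S β) (sym count≡s) s∈S)
  where
  c = count y M
  t = s ∸ c
  N = M + t
  c≤s : c ≤ s
  c≤s = ≤-trans (m≤m+n c m) c+m≤s
  m≤N : m ≤ N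
  m≤N = ≤-trans (+-cancelˡ-≤ c m t (subst (c + m ≤_) (sym (m+[n∸m]≡n c≤s)) c+m≤s)) (m≤n+m t M)
  count≡s : count y N ≡ s
  count≡s = trans (count-eventuallyOne y≥M t) (m+[n∸m]≡n c≤s)

reduction-diagonal : ∀ {β T} {u v : Cantor → Cantor} →
  Continuous u → (∀ x y → A (S β) x y ⇔ A T (u x) (v y)) → ∀ {y} → EventuallyOne y → u y ≗ v y
reduction-diagonal {β} {T} {u} {v} cu red {y} ev =
  flip-limit {T} approx (λ a → A-irreflexive {S β} {y} (Equivalence.from (red y y) a))
  where
  approx : ∀ q → ∃[ z ] (z ≈[ q ] u y × A T z (v y))
  approx q with cu y q
  ... | m , close with switch-off-in-S β ev m
  ... | N , m≤N , a = u (y [ N ≔ false ]) ,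
    (λ i i<q → sym (close (y [ N ≔ false ]) y≈ i i<q)) ,
    Equivalence.to (red (y [ N ≔ false ]) y) a
    where
    y≈ : y ≈[ m ] (y [ N ≔ false ])
    y≈ j j<m = sym (update-≢ y false (<⇒≢ (<-≤-trans j<m m≤N)))

Chain : (ℕ → Set) → ℕ → (ℕ → Cantor) → Set
Chain T L σ = ∀ k → k < L → A T (σ (suc k)) (σ k)

chain-⊆ : ∀ {T L σ} → Chain T L σ → ∀ {j m} → j ≤ m → m ≤ L → σ m ⊆ σ j
chain-⊆ ch {m = zero} z≤n _ i h = h
chain-⊆ {T} ch {j} {suc m} j≤1+m m<L i h with m≤n⇒m<n∨m≡n j≤1+m
... | inj₂ refl      = h
... | inj₁ (s≤s j≤m) = chain-⊆ {T} ch j≤m (<⇒≤ m<L) i (A⇒⊆ {T} (ch m m<L) i h)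

chain-count-≤ : ∀ {T L σ} → Chain T L σ → ∀ q {j m} → j ≤ m → m ≤ L →
  count (σ j) q ≤ count (σ m) q + (m ∸ j)
chain-count-≤ {σ = σ} ch q {m = zero} z≤n _ = m≤m+n (count (σ 0) q) 0
chain-count-≤ {T} {σ = σ} ch q {j} {suc m} j≤1+m m<L with m≤n⇒m<n∨m≡n j≤1+m
... | inj₂ refl      = m≤m+n _ _
... | inj₁ (s≤s j≤m) = begin
  count (σ j) q                        ≤⟨ chain-count-≤ {T} ch q j≤m (<⇒≤ m<L) ⟩
  count (σ m) q + (m ∸ j)              ≤⟨ +-monoˡ-≤ (m ∸ j) (count-A-≤-suc (ch m m<L)) ⟩
  suc (count (σ (suc m)) q) + (m ∸ j)  ≡⟨ +-suc (count (σ (suc m)) q) (m ∸ j) ⟨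
  count (σ (suc m)) q + suc (m ∸ j)    ≡⟨ cong (count (σ (suc m)) q +_) (+-∸-assoc 1 j≤m) ⟨
  count (σ (suc m)) q + (suc m ∸ j)    ∎
  where
  open ≤-Reasoning
  count-A-≤-suc : ∀ {x y} → A T x y → count y q ≤ suc (count x q)
  count-A-≤-suc a with A⇒Flip {T} a
  ... | _ , f , _ = count-flip-≤-suc f q

bit-switch : ∀ (f : ℕ → Bool) m → f m ≡ false → f 0 ≡ true →
  ∃[ k ] (k < m × f (suc k) ≡ false × f k ≡ true)
bit-switch f zero    fm f0 = contradiction (trans (sym fm) f0) λ ()
bit-switch f (suc m) fm f0 with f m in fm'
... | true  = m , ≤-refl , fm , fm'
... | false with bit-switch f m fm' f0
...   | k , k<m , fk' , fk = k , m<n⇒m<1+n k<m , fk' , fk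

chain-switch : ∀ {T L σ a m} → Chain T L σ → m ≤ L → σ m a ≡ false → σ 0 a ≡ true →
  ∃[ k ] (k < m × T (count (σ (suc k)) a))
chain-switch {T} {σ = σ} {a} ch m≤L σma σ0a with bit-switch (λ k → σ k a) _ σma σ0a
... | k , k<m , σ1+k-off , σk-on with A⇒Flip {T} (ch k (<-≤-trans k<m m≤L))
... | p , f , Tp with a ≟ p
... | yes refl = k , k<m , Tp
... | no a≢p   = contradiction (trans (sym σ1+k-off) (trans (agree f a a≢p) σk-on)) λ ()

Sparse : ℕ → (ℕ → Set) → Set
Sparse K T = ∀ {a b} → T a → T b → a < b → a + suc K ≤ b

-- If the last flips were at b < a, the chain π must switch bit a on earlier, at a count that
-- exceeds the count at a below ρ's last flip by at least one and at most K: impossible in a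
-- K-sparse set.
last-flips-ordered : ∀ {T K} → Sparse K T → ∀ {ρ π} → Chain T (suc K) ρ → Chain T (suc K) π →
  ρ (suc K) ≗ π (suc K) → ρ 0 ≗ π 0 →
  ∀ {a b} → Flip (ρ (suc K)) a (ρ K) → T (count (ρ (suc K)) a) → Flip (π (suc K)) b (π K) → ¬ b < a
last-flips-ordered {T} {K} sparse {ρ} {π} chρ chπ top bottom {a} {b} fρ Ta fπ b<a =
  impossible (chain-switch {T} chπ (n≤1+n K) πKa π0a)
  where
  πKa : π K a ≡ false
  πKa = trans (sym (agree fπ a (>⇒≢ b<a))) (trans (sym (top a)) (off fρ))
  π0a : π 0 a ≡ true
  π0a = trans (sym (bottom a)) (chain-⊆ {T} chρ z≤n (n≤1+n K) a (on fρ))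
  c₁ = count (π (suc K)) a
  Tc₁ : T c₁
  Tc₁ = subst T (count-cong a (λ i _ → top i)) Ta
  impossible : ∃[ k ] (k < K × T (count (π (suc k)) a)) → ⊥
  impossible (k , k<K , Tc₂) = 1+n≰n (+-cancelˡ-≤ c₁ (suc K) K (begin
    c₁ + suc K                ≤⟨ sparse Tc₁ Tc₂ c₁<c₂ ⟩
    count (π (suc k)) a       ≤⟨ chain-count-≤ {T} chπ a (m≤n⇒m≤1+n k<K) ≤-refl ⟩
    c₁ + (K ∸ k)              ≤⟨ +-monoʳ-≤ c₁ (m∸n≤m K k) ⟩
    c₁ + K                    ∎))
    where
    open ≤-Reasoning
    c₁<c₂ : c₁ < count (π (suc k)) a
    c₁<c₂ = ≤-trans (≤-reflexive (sym (count-flip-> fπ b<a)))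
                    (count-mono (chain-⊆ {T} chπ k<K (n≤1+n K)) a)

chain-penultimate : ∀ {T K} → Sparse K T → ∀ {ρ π} → Chain T (suc K) ρ → Chain T (suc K) π →
  ρ (suc K) ≗ π (suc K) → ρ 0 ≗ π 0 → ρ K ≗ π K
chain-penultimate {T} sparse chρ chπ top bottom
  with A⇒Flip {T} (chρ _ ≤-refl) | A⇒Flip {T} (chπ _ ≤-refl)
... | a , fρ , Ta | b , fπ , Tb with <-cmp a b
... | tri< a<b _ _ =
  ⊥-elim (last-flips-ordered sparse chπ chρ (λ i → sym (top i)) (λ i → sym (bottom i)) fπ Tb fρ a<b)
... | tri≈ _ refl _ = Flip-functional fρ fπ top
... | tri> _ _ b<a = ⊥-elim (last-flips-ordered sparse chρ chπ top bottom fρ Ta fπ b<a)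

S-sparse : ∀ {β K} → (∀ i → K ≤ β i) → Sparse K (S β)
S-sparse {β} {K} K≤β {a} {b} (l₁ , refl) (l₂ , refl) a<b with l₂ ≤? l₁
... | yes l₂≤l₁ = contradiction (sumTo-mono _ l₂≤l₁) (<⇒≱ a<b)
... | no l₂≰l₁  = ≤-trans (+-monoʳ-≤ (sumTo l₁ _) (s≤s (K≤β l₁))) (sumTo-mono _ (≰⇒> l₂≰l₁))

sumTo-β-suc : ∀ n l → sumTo (suc l) (λ i → suc (β n i)) ≡ suc n + sumTo l (λ i → suc (β (suc n) i))
sumTo-β-suc n zero    = sym (+-identityʳ (suc n))
sumTo-β-suc n (suc l) = begin
  sumTo (suc l) f + suc (suc l + n)       ≡⟨ cong (_+ suc (suc l + n)) (sumTo-β-suc n l) ⟩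
  suc n + sumTo l g + suc (suc (l + n))   ≡⟨ +-assoc (suc n) (sumTo l g) _ ⟩
  suc n + (sumTo l g + suc (suc (l + n))) ≡⟨ cong (λ k → suc n + (sumTo l g + suc k)) (+-suc l n) ⟨
  suc n + (sumTo l g + suc (l + suc n))   ∎
  where
  open ≡-Reasoning
  f g : ℕ → ℕ
  f i = suc (β n i)
  g i = suc (β (suc n) i)

S-β-suc : ∀ n c → S (β (suc n)) c ⇔ S (β n) (suc n + c)
S-β-suc n c = mk⇔ (λ { (l , refl) → suc l , sym (sumTo-β-suc n l) }) from
  where
  from : S (β n) (suc n + c) → S (β (suc n)) c
  from (suc l , e) = l , +-cancelˡ-≡ (suc n) _ _ (trans e (sumTo-β-suc n l))

⊕-≈ : ∀ s {x y k} → x ≈[ k ] y → (s ⊕ x) ≈[ k ] (s ⊕ y)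
⊕-≈ []      x≈y = x≈y
⊕-≈ (b ∷ s) x≈y zero    _   = refl
⊕-≈ (b ∷ s) x≈y (suc i) i<k = ⊕-≈ s x≈y i (≤-trans (n≤1+n _) i<k)

⊕-continuous : ∀ s → Continuous (s ⊕_)
⊕-continuous s x k = k , λ y → ⊕-≈ s

⊕-Flip : ∀ s {x p y} → Flip x p y → Flip (s ⊕ x) (length s + p) (s ⊕ y)
⊕-Flip []      f = f
⊕-Flip (b ∷ s) f = record
  { off = off f' ; on = on f'
  ; agree = λ { zero _ → refl ; (suc i) i≢ → agree f' i (λ e → i≢ (cong suc e)) } }
  where f' = ⊕-Flip s f

⊕-Flip⁻¹ : ∀ s {x q y} → Flip (s ⊕ x) q (s ⊕ y) → ∃[ p ] (q ≡ length s + p × Flip x p y)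
⊕-Flip⁻¹ []      {q = q}     f = q , refl , f
⊕-Flip⁻¹ (b ∷ s) {q = zero}  f = contradiction (trans (sym (off f)) (on f)) λ ()
⊕-Flip⁻¹ (b ∷ s) {q = suc q} f with ⊕-Flip⁻¹ s (record
  { off = off f ; on = on f ; agree = λ i i≢q → agree f (suc i) (λ e → i≢q (suc-injective e)) })
... | p , refl , f' = p , refl , f'

count-⊕ : ∀ s x p → count (s ⊕ x) (length s + p) ≡ ones s + count x p
count-⊕ []          x p = refl
count-⊕ (false ∷ s) x p = count-⊕ s x p
count-⊕ (true ∷ s)  x p = cong suc (count-⊕ s x p)

⊕-reduction : ∀ {T T'} s → (∀ c → T' c ⇔ T (ones s + c)) → A T' ≤rc A T
⊕-reduction {T} {T'} s T'⇔T =
  (s ⊕_) , (s ⊕_) , ⊕-continuous s , ⊕-continuous s , λ x y → mk⇔ (to x y) (from x y)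
  where
  to : ∀ x y → A T' x y → A T (s ⊕ x) (s ⊕ y)
  to x y a with A⇒Flip {T'} a
  ... | p , f , t = Flip⇒A {T} (⊕-Flip s f) (subst T (sym (count-⊕ s x p)) (Equivalence.to (T'⇔T _) t))
  from : ∀ x y → A T (s ⊕ x) (s ⊕ y) → A T' x y
  from x y a with A⇒Flip {T} a
  ... | q , f , t with ⊕-Flip⁻¹ s f
  ... | p , refl , f' = Flip⇒A {T'} f' (Equivalence.from (T'⇔T _) (subst T (count-⊕ s x p) t))

ones-replicate-true : ∀ m → ones (replicate m true) ≡ m
ones-replicate-true zero    = refl
ones-replicate-true (suc m) = cong suc (ones-replicate-true m)

B-suc-≤rc-B : ∀ n → B (suc n) ≤rc B n
B-suc-≤rc-B n = ⊕-reduction {S (β n)} {S (β (suc n))} (replicate (suc n) true) λ c →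
  subst (λ k → S (β (suc n)) c ⇔ S (β n) (k + c)) (sym (ones-replicate-true (suc n))) (S-β-suc n c)

step : ℕ → Cantor
step m i = does (m ≤? i)

step-eventuallyOne : ∀ m → EventuallyOne (step m)
step-eventuallyOne m = m , λ i m≤i → dec-true (m ≤? i) m≤i

step-flip : ∀ m → Flip (step (suc m)) m (step m)
step-flip m = record
  { off   = dec-false (suc m ≤? m) 1+n≰n
  ; on    = dec-true (m ≤? m) ≤-refl
  ; agree = agree-off-m
  }
  where
  agree-off-m : ∀ i → i ≢ m → step (suc m) i ≡ step m i
  agree-off-m i i≢m with <-cmp i m
  ... | tri< i<m _ _ =
    trans (dec-false (suc m ≤? i) (λ m<i → <⇒≱ i<m (<⇒≤ m<i))) (sym (dec-false (m ≤? i) (<⇒≱ i<m)))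
  ... | tri≈ _ i≡m _ = contradiction i≡m i≢m
  ... | tri> _ _ m<i = trans (dec-true (suc m ≤? i) m<i) (sym (dec-true (m ≤? i) (<⇒≤ m<i)))

count-step : ∀ m p → count (step m) p ≡ p ∸ m
count-step m zero    = sym (0∸n≡0 m)
count-step m (suc p) = begin
  count (step m) (suc p)             ≡⟨ count-suc (step m) p ⟩
  count (step m) p + bit (step m p)  ≡⟨ cong (_+ bit (step m p)) (count-step m p) ⟩
  p ∸ m + bit (step m p)             ≡⟨ last-bit (m ≤? p) ⟩
  suc p ∸ m                          ∎
  where
  open ≡-Reasoning
  last-bit : Dec (m ≤ p) → p ∸ m + bit (step m p) ≡ suc p ∸ m
  last-bit (yes m≤p) = begin
    p ∸ m + bit (step m p)  ≡⟨ cong (λ b → p ∸ m + bit b) (dec-true (m ≤? p) m≤p) ⟩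
    p ∸ m + 1               ≡⟨ +-comm (p ∸ m) 1 ⟩
    suc (p ∸ m)             ≡⟨ +-∸-assoc 1 m≤p ⟨
    suc p ∸ m               ∎
  last-bit (no m≰p) = begin
    p ∸ m + bit (step m p)  ≡⟨ cong (λ b → p ∸ m + bit b) (dec-false (m ≤? p) m≰p) ⟩
    p ∸ m + 0               ≡⟨ +-identityʳ (p ∸ m) ⟩
    p ∸ m                   ≡⟨ m≤n⇒m∸n≡0 (<⇒≤ (≰⇒> m≰p)) ⟩
    0                       ≡⟨ m≤n⇒m∸n≡0 (≰⇒> m≰p) ⟨
    suc p ∸ m               ∎

count-step-suc : ∀ m → count (step (suc m)) m ≡ 0
count-step-suc m = trans (count-step (suc m) m) (m≤n⇒m∸n≡0 (n≤1+n m))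

B-≰rc-B-suc : ∀ n → ¬ (B n ≤rc B (suc n))
B-≰rc-B-suc n (u , v , cu , _ , red) =
  contradiction (trans (sym V-off) (A⇒⊆ {S (β n)} R-V (suc n) R-on)) λ ()
  where
  T = S (β (suc n))
  c = suc (suc n)

  R : ℕ → Cantor
  R m = step m [ c ≔ false ]

  V : Cantor
  V = step c [ 0 ≔ true ]

  step-edge : ∀ m → A (S (β n)) (step (suc m)) (step m)
  step-edge m = Flip⇒A {S (β n)} (step-flip m) (0 , count-step-suc m)

  R-edge : ∀ {k} → k ≤ n → A (S (β n)) (R (suc (suc k))) (R (suc k))
  R-edge {k} k≤n = Flip⇒A {S (β n)} (Flip-update false (>⇒≢ (s≤s (s≤s k≤n))) (step-flip (suc k)))
    (0 , trans (count-update (step (suc (suc k))) false (≤-trans (n≤1+n _) (s≤s (s≤s k≤n))))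
               (count-step-suc (suc k)))

  R-edge₀ : A (S (β n)) (R 1) (step 1)
  R-edge₀ = switch-off-A {S (β n)} (dec-true (1 ≤? c) (s≤s z≤n)) (1 , count-step 1 c)

  V-edge : A (S (β n)) (step c) V
  V-edge = A-resp-≗ {S (β n)} (λ i → sym (update-self {step c} {0} (dec-false (c ≤? 0) λ ()) i))
    (λ _ → refl)    (update-A {S (β n)} (step c) 0 (0 , refl))

  image-edge : ∀ {x y} → EventuallyOne y → A (S (β n)) x y → A T (u x) (u y)
  image-edge ev a = A-resp-≗ {T} (λ _ → refl) (λ i → sym (reduction-diagonal {β n} {T} cu red ev i))
    (Equivalence.to (red _ _) a)

  ρ π : ℕ → Cantor
  ρ zero    = u (step 1)
  ρ (suc k) = u (R (suc k))
  π k = u (step (suc k))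

  chain-ρ : Chain T c ρ
  chain-ρ zero    _               = image-edge (step-eventuallyOne 1) R-edge₀
  chain-ρ (suc k) (s≤s (s≤s k≤n)) =
    image-edge (update-eventuallyOne c false (step-eventuallyOne (suc k))) (R-edge k≤n)

  chain-π : Chain T c π
  chain-π k _ = image-edge (step-eventuallyOne (suc k)) (step-edge (suc k))

  penultimate : u (R (suc n)) ≗ u (step c)
  penultimate = chain-penultimate {T} (S-sparse (λ i → m≤n+m (suc n) i)) chain-ρ chain-π
    (continuous-≗ cu (λ i → sym (Flip⇒≗off (step-flip c) i))) (λ _ → refl)

  R-V : A (S (β n)) (R (suc n)) V
  R-V = Equivalence.from (red _ _)
    (A-resp-≗ {T} (λ i → sym (penultimate i)) (λ _ → refl) (Equivalence.to (red _ _) V-edge))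

  R-on : R (suc n) (suc n) ≡ true
  R-on = trans (update-≢ (step (suc n)) {c} false (<⇒≢ ≤-refl)) (dec-true (suc n ≤? suc n) ≤-refl)

  V-off : V (suc n) ≡ false
  V-off = trans (update-≢ (step c) {0} {suc n} true λ ()) (dec-false (c ≤? suc n) 1+n≰n)

proposition25 : ∀ (n : ℕ) → (B (suc n) ≤rc B n) × ¬ (B n ≤rc B (suc n))
proposition25 n = B-suc-≤rc-B n , B-≰rc-B-suc n
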